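{- For each integer $k\ge1$, let $G_k(x)=\sum_{n\ge1}g_k(n)x^n$, where $g_k(n)$ is the total number of vertices having exactly $k$ leaves in their subtree, summed over all Schroeder trees with $n$ leaves. Let $L_k(x)$ be the generating function (by number of leaves) for Schroeder trees whose root has exactly $k$ leaves in its subtree. Then, as formal power series, $$G_k(x)=L_k(x)\,\frac{3-x+\sqrt{1-6x+x^2}}{4\sqrt{1-6x+x^2}}.$$
   Context: A Schroeder tree is a rooted planar (ordered) tree in which every non-leaf vertex has at least two children; its size is its number of leaves. The subtree of a vertex $v$ consists of $v$ together with all of its descendants. The square root denotes the formal power series with constant term $1$. -}

module Defs where

open import Data.Nat as ℕ using (ℕ; zero; suc; _∸_)
open import Data.List using (List; []; _∷_; map; upTo; length; filter)
open import Data.List.Relation.Unary.All using (All)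
open import Data.List.Membership.Propositional using (_∈_)
open import Data.List.Relation.Unary.Unique.Propositional using (Unique)
open import Data.Rational as ℚ using (ℚ; 0ℚ; 1ℚ; _+_; _*_; -_)
open import Data.Sum using (_⊎_)
open import Data.Product using (_×_)
open import Relation.Binary.PropositionalEquality using (_≡_)
open import Relation.Nullary.Decidable using (does)
open import Data.Bool using (if_then_else_)
open import Function.Bundles using (_⇔_)

data Tree : Set where
  node : List Tree → Tree

mutual
  Schroeder : Tree → Set
  Schroeder (node ts) = (length ts ≡ 0 ⊎ 2 ℕ.≤ length ts) × SchroederF ts

  SchroederF : List Tree → Set
  SchroederF [] = Data.Unit.⊤ where import Data.Unit
  SchroederF (t ∷ ts) = Schroeder t × SchroederF ts

mutual
  leaves : Tree → ℕ
  leaves (node []) = 1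
  leaves (node (t ∷ ts)) = leaves t ℕ.+ leavesF ts

  leavesF : List Tree → ℕ
  leavesF [] = 0
  leavesF (t ∷ ts) = leaves t ℕ.+ leavesF ts

mutual
  countK : ℕ → Tree → ℕ
  countK k (node ts) = (if does (leaves (node ts) ℕ.≟ k) then 1 else 0) ℕ.+ countKF k ts

  countKF : ℕ → List Tree → ℕ
  countKF k [] = 0
  countKF k (t ∷ ts) = countK k t ℕ.+ countKF k ts

IsEnumeration : (ℕ → List Tree) → Set
IsEnumeration enum =
  (n : ℕ) → Unique (enum n) × ((t : Tree) → (t ∈ enum n) ⇔ (Schroeder t × leaves t ≡ n))

sumℕ : List ℕ → ℕ
sumℕ [] = 0
sumℕ (x ∷ xs) = x ℕ.+ sumℕ xs

FPS : Set
FPS = ℕ → ℚ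

ℕtoℚ : ℕ → ℚ
ℕtoℚ m = Data.Integer.+ m ℚ./ 1
  where import Data.Integer

sumℚ : List ℚ → ℚ
sumℚ [] = 0ℚ
sumℚ (x ∷ xs) = x + sumℚ xs

_⊕_ : FPS → FPS → FPS
(f ⊕ g) n = f n + g n

_⊛_ : FPS → FPS → FPS
(f ⊛ g) n = sumℚ (map (λ i → f i * g (n ∸ i)) (upTo (suc n)))

poly : List ℚ → FPS
poly [] n = 0ℚ
poly (c ∷ cs) zero = c
poly (c ∷ cs) (suc n) = poly cs n

one : FPS
one = poly (1ℚ ∷ [])

disc : FPS
disc = poly (1ℚ ∷ - (ℕtoℚ 6) ∷ 1ℚ ∷ [])

threeMinusX : FPS
threeMinusX = poly (ℕtoℚ 3 ∷ - 1ℚ ∷ [])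

four : FPS
four = poly (ℕtoℚ 4 ∷ [])

IsSqrt : FPS → FPS → Set
IsSqrt T P = (T 0 ≡ 1ℚ) × ((n : ℕ) → (T ⊛ T) n ≡ P n)

IsInverse : FPS → FPS → Set
IsInverse U F = (n : ℕ) → (U ⊛ F) n ≡ one n

G : (ℕ → List Tree) → ℕ → FPS
G enum k zero = 0ℚ
G enum k (suc n) = ℕtoℚ (sumℕ (map (countK k) (enum (suc n))))

L : (ℕ → List Tree) → ℕ → FPS
L enum k n = ℕtoℚ (length (filter (λ t → leaves t ℕ.≟ k) (enum n)))

{-# OPTIONS --safe #-}
module Submission where

-- Removing the first subtree t from the root of a non-leaf Schroeder tree leaves
-- either a single subtree v or the subtree list of a non-leaf tree v, and the pair
-- (t, v) determines the tree.  So the series a of Schroeder trees and ν of those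
-- with a non-leaf root satisfy a = x + ν and ν = a (a + ν), whence
-- (1 + x − 4a)² = 1 − 6x + x² and 1 + x − 4a is the square root.  Splitting the
-- vertices with k leaves into the root and the rest (series h) along the same
-- decomposition gives g = l + h and h = g (a + ν) + a (g + h), where g = G_k and
-- l = L_k; eliminating h and ν leaves g (1 + x − 4a) = l (1 − a), and
-- 4 (1 − a) = 3 − x + (1 + x − 4a).

open import Defs
open import Data.Nat using (ℕ; _≥_)
open import Data.List using (List)
open import Relation.Binary.PropositionalEquality using (_≡_; trans)

module TreeCounting where

  open import Data.Nat as ℕ using (ℕ; zero; suc; _∸_; _+_; _*_; _≤_; z≤n; s≤s)
  import Data.Nat.Properties as ℕ
  open import Data.Nat.ListAction using (sum)
  open import Data.Nat.ListAction.Properties using (sum-↭)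
  open import Data.Nat.Tactic.RingSolver using (solve-∀)
  open import Data.List as List using (List; []; _∷_; map; upTo; _++_; concatMap; length; filter)
  import Data.List.Properties as List
  open import Data.List.Membership.Propositional using (_∈_; find; lose)
  open import Data.List.Membership.Propositional.Properties
    using (∈-++⁺ˡ; ∈-++⁺ʳ; ∈-++⁻; ∈-map⁺; ∈-map⁻; ∈-concatMap⁺; ∈-concatMap⁻;
           ∈-upTo⁺; ∈-upTo⁻)
  open import Data.List.Membership.Propositional.Properties.WithK using (unique∧set⇒bag)
  open import Data.List.Relation.Binary.BagAndSetEquality using (∼bag⇒↭)
  open import Data.List.Relation.Binary.Permutation.Propositional using (_↭_)
  import Data.List.Relation.Binary.Permutation.Propositional.Properties as ↭
  open import Data.List.Relation.Unary.Any using (here; there)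
  import Data.List.Relation.Unary.All as All
  open import Data.List.Relation.Unary.AllPairs using ([]; _∷_)
  open import Data.List.Relation.Unary.Unique.Propositional using (Unique)
  import Data.List.Relation.Unary.Unique.Propositional.Properties as Unique
  open import Data.Product using (∃; _×_; _,_; proj₁; proj₂)
  open import Data.Sum using (inj₁; inj₂)
  open import Data.Empty using (⊥; ⊥-elim)
  open import Data.Unit using (tt)
  open import Data.Bool using (if_then_else_)
  open import Function using (_∘_)
  open import Function.Bundles using (mk⇔; Equivalence)
  open import Relation.Binary.PropositionalEquality
  open import Relation.Nullary.Decidable using (does; yes; no; dec-true; dec-false)

  sumBy : ∀ {A : Set} → (A → ℕ) → List A → ℕ
  sumBy w xs = sumℕ (map w xs)

  sumℕ≡sum : ∀ xs → sumℕ xs ≡ sum xs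
  sumℕ≡sum []       = refl
  sumℕ≡sum (x ∷ xs) = cong (x +_) (sumℕ≡sum xs)

  sumBy-↭ : ∀ {A : Set} (w : A → ℕ) {xs ys} → xs ↭ ys → sumBy w xs ≡ sumBy w ys
  sumBy-↭ w {xs} {ys} xs↭ys =
    trans (sumℕ≡sum (map w xs)) (trans (sum-↭ (↭.map⁺ w xs↭ys)) (sym (sumℕ≡sum (map w ys))))

  sumBy-unique : ∀ {A : Set} (w : A → ℕ) {xs ys} → Unique xs → Unique ys →
                 (∀ {z} → z ∈ xs → z ∈ ys) → (∀ {z} → z ∈ ys → z ∈ xs) →
                 sumBy w xs ≡ sumBy w ys
  sumBy-unique w xs! ys! xs⊆ys ys⊆xs =
    sumBy-↭ w (∼bag⇒↭ (unique∧set⇒bag xs! ys! (mk⇔ xs⊆ys ys⊆xs)))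

  sumBy-++ : ∀ {A : Set} (w : A → ℕ) xs ys → sumBy w (xs ++ ys) ≡ sumBy w xs + sumBy w ys
  sumBy-++ w []       ys = refl
  sumBy-++ w (x ∷ xs) ys =
    trans (cong (w x +_) (sumBy-++ w xs ys)) (sym (ℕ.+-assoc (w x) (sumBy w xs) (sumBy w ys)))

  sumBy-concatMap : ∀ {A B : Set} (w : B → ℕ) (f : A → List B) xs →
                    sumBy w (concatMap f xs) ≡ sumBy (sumBy w ∘ f) xs
  sumBy-concatMap w f []       = refl
  sumBy-concatMap w f (x ∷ xs) =
    trans (sumBy-++ w (f x) (concatMap f xs)) (cong (sumBy w (f x) +_) (sumBy-concatMap w f xs))

  sumBy-map : ∀ {A B : Set} (w : B → ℕ) (f : A → B) xs → sumBy w (map f xs) ≡ sumBy (w ∘ f) xs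
  sumBy-map w f []       = refl
  sumBy-map w f (x ∷ xs) = cong (w (f x) +_) (sumBy-map w f xs)

  sumBy-cong-∈ : ∀ {A : Set} {v w : A → ℕ} xs → (∀ {z} → z ∈ xs → v z ≡ w z) →
                 sumBy v xs ≡ sumBy w xs
  sumBy-cong-∈ []       v≡w = refl
  sumBy-cong-∈ (x ∷ xs) v≡w = cong₂ _+_ (v≡w (here refl)) (sumBy-cong-∈ xs (v≡w ∘ there))

  sumBy-cong : ∀ {A : Set} {v w : A → ℕ} xs → (∀ z → v z ≡ w z) → sumBy v xs ≡ sumBy w xs
  sumBy-cong xs v≡w = sumBy-cong-∈ xs (λ {z} _ → v≡w z)

  sumBy-+ : ∀ {A : Set} (v w : A → ℕ) xs → sumBy (λ x → v x + w x) xs ≡ sumBy v xs + sumBy w xs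
  sumBy-+ v w []       = refl
  sumBy-+ v w (x ∷ xs) =
    trans (cong (v x + w x +_) (sumBy-+ v w xs)) (interchange (v x) (w x) (sumBy v xs) (sumBy w xs))
    where
    interchange : ∀ a b c d → a + b + (c + d) ≡ (a + c) + (b + d)
    interchange = solve-∀

  sumBy-*ʳ : ∀ {A : Set} (w : A → ℕ) c xs → sumBy (λ x → w x * c) xs ≡ sumBy w xs * c
  sumBy-*ʳ w c []       = refl
  sumBy-*ʳ w c (x ∷ xs) =
    trans (cong (w x * c +_) (sumBy-*ʳ w c xs)) (sym (ℕ.*-distribʳ-+ c (w x) (sumBy w xs)))

  sumBy-const : ∀ {A : Set} c (xs : List A) → sumBy (λ _ → c) xs ≡ length xs * c
  sumBy-const c []       = refl
  sumBy-const c (x ∷ xs) = cong (c +_) (sumBy-const c xs)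

  ∈-concatMap-witness : ∀ {A B : Set} (f : A → List B) xs {y} → y ∈ concatMap f xs →
                        ∃ λ x → x ∈ xs × y ∈ f x
  ∈-concatMap-witness f xs y∈ = find (∈-concatMap⁻ f {xs = xs} y∈)

  concatMap-unique : ∀ {A B : Set} (index : B → A) (f : A → List B) {xs} → Unique xs →
                     (∀ {x} → x ∈ xs → Unique (f x)) →
                     (∀ {x y} → x ∈ xs → y ∈ f x → index y ≡ x) →
                     Unique (concatMap f xs)
  concatMap-unique index f {[]}     _          _        _     = []
  concatMap-unique index f {x ∷ xs} (x∉xs ∷ xs!) f-unique index≡ =
    Unique.++⁺ (f-unique (here refl))
               (concatMap-unique index f xs! (f-unique ∘ there) (index≡ ∘ there))
               disjoint
    where
    disjoint : ∀ {y} → y ∈ f x × y ∈ concatMap f xs → ⊥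
    disjoint (y∈fx , y∈rest) with ∈-concatMap-witness f xs y∈rest
    ... | x′ , x′∈xs , y∈fx′ =
      Unique.Unique[x∷xs]⇒x∉xs (x∉xs ∷ xs!)
        (subst (_∈ xs) (trans (sym (index≡ (there x′∈xs) y∈fx′)) (index≡ (here refl) y∈fx))
               x′∈xs)

  infixl 7 _⋆_
  _⋆_ : (ℕ → ℕ) → (ℕ → ℕ) → ℕ → ℕ
  (f ⋆ h) n = sumBy (λ i → f i * h (n ∸ i)) (upTo (suc n))

  children : Tree → List Tree
  children (node ts) = ts

  firstChild : Tree → Tree
  firstChild (node [])      = node []
  firstChild (node (t ∷ _)) = t

  otherChildren : Tree → Tree
  otherChildren (node [])       = node []
  otherChildren (node (_ ∷ ts)) = node ts

  isInternal : Tree → ℕ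
  isInternal (node [])      = 0
  isInternal (node (_ ∷ _)) = 1

  prependChild : Tree → Tree → List Tree
  prependChild t (node [])       = []
  prependChild t (node (u ∷ us)) = node (t ∷ u ∷ us) ∷ []

  leafOfSize : ℕ → List Tree
  leafOfSize 1 = node [] ∷ []
  leafOfSize _ = []

  1≤leaves : ∀ t → 1 ≤ leaves t
  1≤leaves (node [])       = s≤s z≤n
  1≤leaves (node (t ∷ ts)) = ℕ.≤-trans (1≤leaves t) (ℕ.m≤m+n (leaves t) (leavesF ts))

  prependChild⁻ : ∀ {t v z} → z ∈ prependChild t v →
                  ∃ λ u → ∃ λ us → v ≡ node (u ∷ us) × z ≡ node (t ∷ u ∷ us)
  prependChild⁻ {v = node (u ∷ us)} (here refl) = u , us , refl , refl

  prependChild-unique : ∀ t v → Unique (prependChild t v)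
  prependChild-unique t (node [])       = []
  prependChild-unique t (node (u ∷ us)) = All.[] ∷ []

  module Decomposition (enum : ℕ → List Tree) (isEnum : IsEnumeration enum) where

    enum-unique : ∀ n → Unique (enum n)
    enum-unique n = proj₁ (isEnum n)

    ∈enum⁻ : ∀ {n t} → t ∈ enum n → Schroeder t × leaves t ≡ n
    ∈enum⁻ {n} {t} = Equivalence.to (proj₂ (isEnum n) t)

    ∈enum⁺ : ∀ {n t} → Schroeder t → leaves t ≡ n → t ∈ enum n
    ∈enum⁺ {n} {t} st lt = Equivalence.from (proj₂ (isEnum n) t) (st , lt)

    enum-0 : enum 0 ≡ []
    enum-0 with enum 0 | ∈enum⁻ {0}
    ... | []    | _     = refl
    ... | z ∷ _ | ∈enum = ⊥-elim (ℕ.<⇒≢ (1≤leaves z) (sym (proj₂ (∈enum (here refl)))))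

    withTwoChildren : ℕ → Tree → List Tree
    withTwoChildren m t = map (λ u → node (t ∷ u ∷ [])) (enum m)

    withPrependedChild : ℕ → Tree → List Tree
    withPrependedChild m t = concatMap (prependChild t) (enum m)

    -- The subtrees of the root after the first one, t, form either a single tree
    -- with m leaves or the list of subtrees of a non-leaf tree with m leaves.
    withFirstChild : ℕ → Tree → List Tree
    withFirstChild m t = withTwoChildren m t ++ withPrependedChild m t

    byFirstChildSize : ℕ → ℕ → List Tree
    byFirstChildSize n i = concatMap (withFirstChild (n ∸ i)) (enum i)

    internalTrees : ℕ → List Tree
    internalTrees n = concatMap (byFirstChildSize n) (upTo (suc n))

    decomposition : ℕ → List Tree
    decomposition n = leafOfSize n ++ internalTrees n

    ∈withPrependedChild⁻ : ∀ {m t z} → z ∈ withPrependedChild m t →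
                           ∃ λ u → ∃ λ us → node (u ∷ us) ∈ enum m × z ≡ node (t ∷ u ∷ us)
    ∈withPrependedChild⁻ {m} {t} z∈ with ∈-concatMap-witness (prependChild t) (enum m) z∈
    ... | v , v∈ , z∈ptv with prependChild⁻ {t} {v} z∈ptv
    ...   | u , us , refl , refl = u , us , v∈ , refl

    withFirstChild-shape : ∀ {m t z} → z ∈ withFirstChild m t →
                           ∃ λ u → ∃ λ us → z ≡ node (t ∷ u ∷ us)
    withFirstChild-shape {m} {t} z∈ with ∈-++⁻ (withTwoChildren m t) z∈
    ... | inj₁ z∈two    with ∈-map⁻ (λ u → node (t ∷ u ∷ [])) z∈two
    ...   | u , _ , refl = u , [] , refl
    withFirstChild-shape z∈ | inj₂ z∈prepended with ∈withPrependedChild⁻ z∈prepended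
    ...   | u , us , _ , refl = u , us , refl

    withFirstChild-sound : ∀ {m t z} → Schroeder t → z ∈ withFirstChild m t →
                           Schroeder z × leaves z ≡ leaves t + m
    withFirstChild-sound {m} {t} st z∈ with ∈-++⁻ (withTwoChildren m t) z∈
    ... | inj₁ z∈two with ∈-map⁻ (λ u → node (t ∷ u ∷ [])) z∈two
    ...   | u , u∈ , refl with ∈enum⁻ u∈
    ...     | su , refl =
      (inj₂ (s≤s (s≤s z≤n)) , st , su , tt) , cong (leaves t +_) (ℕ.+-identityʳ (leaves u))
    withFirstChild-sound st z∈ | inj₂ z∈prepended with ∈withPrependedChild⁻ z∈prepended
    ...   | u , us , v∈ , refl with ∈enum⁻ v∈
    ...     | (_ , sus) , refl = (inj₂ (s≤s (s≤s z≤n)) , st , sus) , refl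

    withFirstChild-complete : ∀ m t u us → Schroeder u → SchroederF us → leavesF (u ∷ us) ≡ m →
                              node (t ∷ u ∷ us) ∈ withFirstChild m t
    withFirstChild-complete m t u []       su _   lu =
      ∈-++⁺ˡ (∈-map⁺ (λ u → node (t ∷ u ∷ []))
                     (∈enum⁺ su (trans (sym (ℕ.+-identityʳ (leaves u))) lu)))
    withFirstChild-complete m t u (w ∷ ws) su sus l =
      ∈-++⁺ʳ (withTwoChildren m t)
        (∈-concatMap⁺ (prependChild t)
                      (lose (∈enum⁺ (inj₂ (s≤s (s≤s z≤n)) , su , sus) l) (here refl)))

    decomposition-sound : ∀ {n z} → z ∈ decomposition n → Schroeder z × leaves z ≡ n
    decomposition-sound {n} z∈ with ∈-++⁻ (leafOfSize n) z∈
    decomposition-sound {1} z∈ | inj₁ (here refl) = (inj₁ refl , tt) , refl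
    ... | inj₂ z∈internal with ∈-concatMap-witness (byFirstChildSize n) (upTo (suc n)) z∈internal
    ...   | i , i∈ , z∈i with ∈-concatMap-witness (withFirstChild (n ∸ i)) (enum i) z∈i
    ...     | t , t∈ , z∈t with ∈enum⁻ t∈
    ...       | st , refl with withFirstChild-sound st z∈t
    ...         | sz , lz = sz , trans lz (ℕ.m+[n∸m]≡n (ℕ.≤-pred (∈-upTo⁻ i∈)))

    decomposition-complete : ∀ {n} z → Schroeder z → leaves z ≡ n → z ∈ decomposition n
    decomposition-complete (node [])               _                   refl =
      ∈-++⁺ˡ {xs = leafOfSize 1} {ys = internalTrees 1} (here refl)
    decomposition-complete (node (t ∷ []))         (inj₁ () , _)       _
    decomposition-complete (node (t ∷ []))         (inj₂ (s≤s ()) , _) _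
    decomposition-complete {n} (node (t ∷ u ∷ us)) (_ , st , su , sus) lz =
      ∈-++⁺ʳ (leafOfSize n)
        (∈-concatMap⁺ (byFirstChildSize n) (lose (∈-upTo⁺ (s≤s i≤n))
          (∈-concatMap⁺ (withFirstChild (n ∸ i)) (lose (∈enum⁺ st refl)
            (withFirstChild-complete (n ∸ i) t u us su sus (sym n∸i≡rest))))))
      where
      i = leaves t
      i≤n : i ≤ n
      i≤n = subst (i ≤_) lz (ℕ.m≤m+n i (leavesF (u ∷ us)))
      n∸i≡rest : n ∸ i ≡ leavesF (u ∷ us)
      n∸i≡rest = trans (cong (_∸ i) (sym lz)) (ℕ.m+n∸m≡n i (leavesF (u ∷ us)))

    withFirstChild-unique : ∀ m t → Unique (withFirstChild m t)
    withFirstChild-unique m t =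
      Unique.++⁺ (Unique.map⁺ second-injective (enum-unique m))
                 (concatMap-unique otherChildren (prependChild t) (enum-unique m)
                    (λ {v} _ → prependChild-unique t v) otherChildren≡)
                 disjoint
      where
      second-injective : ∀ {u u′} → node (t ∷ u ∷ []) ≡ node (t ∷ u′ ∷ []) → u ≡ u′
      second-injective refl = refl
      otherChildren≡ : ∀ {v y} → v ∈ enum m → y ∈ prependChild t v → otherChildren y ≡ v
      otherChildren≡ {v} _ y∈ with prependChild⁻ {t} {v} y∈
      ... | _ , _ , refl , refl = refl
      -- a common element would come from a non-leaf tree with a single subtree
      disjoint : ∀ {y} → y ∈ withTwoChildren m t × y ∈ withPrependedChild m t → ⊥
      disjoint (y∈two , y∈prepended) with ∈-map⁻ (λ u → node (t ∷ u ∷ [])) y∈two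
      ... | _ , _ , refl with ∈withPrependedChild⁻ y∈prepended
      ...   | _ , [] , v∈ , refl with ∈enum⁻ v∈
      ...     | (inj₁ () , _) , _
      ...     | (inj₂ (s≤s ()) , _) , _

    byFirstChildSize-unique : ∀ n i → Unique (byFirstChildSize n i)
    byFirstChildSize-unique n i =
      concatMap-unique firstChild (withFirstChild (n ∸ i)) (enum-unique i)
        (λ {t} _ → withFirstChild-unique (n ∸ i) t) firstChild≡
      where
      firstChild≡ : ∀ {t y} → t ∈ enum i → y ∈ withFirstChild (n ∸ i) t → firstChild y ≡ t
      firstChild≡ _ y∈ with withFirstChild-shape y∈
      ... | _ , _ , refl = refl

    internalTrees-unique : ∀ n → Unique (internalTrees n)
    internalTrees-unique n =
      concatMap-unique (leaves ∘ firstChild) (byFirstChildSize n) (Unique.upTo⁺ (suc n))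
        (λ {i} _ → byFirstChildSize-unique n i) firstChildSize≡
      where
      firstChildSize≡ : ∀ {i y} → i ∈ upTo (suc n) → y ∈ byFirstChildSize n i →
                        leaves (firstChild y) ≡ i
      firstChildSize≡ {i} _ y∈ with ∈-concatMap-witness (withFirstChild (n ∸ i)) (enum i) y∈
      ... | t , t∈ , y∈t with withFirstChild-shape y∈t
      ...   | _ , _ , refl = proj₂ (∈enum⁻ t∈)

    decomposition-unique : ∀ n → Unique (decomposition n)
    decomposition-unique n = Unique.++⁺ (leafOfSize-unique n) (internalTrees-unique n) disjoint
      where
      leafOfSize-unique : ∀ n → Unique (leafOfSize n)
      leafOfSize-unique 0             = []
      leafOfSize-unique 1             = All.[] ∷ []
      leafOfSize-unique (suc (suc n)) = []
      ∈leafOfSize⁻ : ∀ n {y} → y ∈ leafOfSize n → y ≡ node []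
      ∈leafOfSize⁻ 1 (here y≡leaf) = y≡leaf
      disjoint : ∀ {y} → y ∈ leafOfSize n × y ∈ internalTrees n → ⊥
      disjoint (y∈leaf , y∈internal)
        with ∈-concatMap-witness (byFirstChildSize n) (upTo (suc n)) y∈internal
      ... | i , _ , y∈i with ∈-concatMap-witness (withFirstChild (n ∸ i)) (enum i) y∈i
      ...   | t , _ , y∈t with withFirstChild-shape y∈t | ∈leafOfSize⁻ n y∈leaf
      ...     | _ , _ , refl | ()

    sumBy-enum : ∀ (w : Tree → ℕ) n →
                 sumBy w (enum n) ≡ sumBy w (leafOfSize n) + sumBy w (internalTrees n)
    sumBy-enum w n =
      trans (sumBy-unique w (enum-unique n) (decomposition-unique n)
               (λ z∈ → let sz , lz = ∈enum⁻ z∈ in decomposition-complete _ sz lz)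
               (λ z∈ → let sz , lz = decomposition-sound {n} z∈ in ∈enum⁺ sz lz))
            (sumBy-++ w (leafOfSize n) (internalTrees n))

    sumBy-withFirstChild : ∀ (w : Tree → ℕ) m t → sumBy w (withFirstChild m t) ≡
      sumBy (λ u → w (node (t ∷ u ∷ []))) (enum m) + sumBy (sumBy w ∘ prependChild t) (enum m)
    sumBy-withFirstChild w m t =
      trans (sumBy-++ w (withTwoChildren m t) (withPrependedChild m t))
            (cong₂ _+_ (sumBy-map w (λ u → node (t ∷ u ∷ [])) (enum m))
                       (sumBy-concatMap w (prependChild t) (enum m)))

    sumBy-internalTrees : ∀ (w : Tree → ℕ) n → sumBy w (internalTrees n) ≡
      sumBy (λ i → sumBy (sumBy w ∘ withFirstChild (n ∸ i)) (enum i)) (upTo (suc n))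
    sumBy-internalTrees w n =
      trans (sumBy-concatMap w (byFirstChildSize n) (upTo (suc n)))
            (sumBy-cong (upTo (suc n)) λ i → sumBy-concatMap w (withFirstChild (n ∸ i)) (enum i))

    count : ℕ → ℕ
    count n = length (enum n)

    internal : ℕ → ℕ
    internal n = sumBy isInternal (enum n)

    remainders : ℕ → ℕ
    remainders m = count m + internal m

    count-internalTrees : ∀ (w : Tree → ℕ) → (∀ t u us → w (node (t ∷ u ∷ us)) ≡ 1) →
                          ∀ n → sumBy w (internalTrees n) ≡ (count ⋆ remainders) n
    count-internalTrees w w≡1 n =
      trans (sumBy-internalTrees w n) (sumBy-cong (upTo (suc n)) λ i →
        trans (sumBy-cong (enum i) (per-first-child (n ∸ i)))
              (sumBy-const (remainders (n ∸ i)) (enum i)))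
      where
      prepended : ∀ t v → sumBy w (prependChild t v) ≡ isInternal v
      prepended t (node [])       = refl
      prepended t (node (u ∷ us)) = trans (ℕ.+-identityʳ _) (w≡1 t u us)
      per-first-child : ∀ m t → sumBy w (withFirstChild m t) ≡ remainders m
      per-first-child m t =
        trans (sumBy-withFirstChild w m t)
              (cong₂ _+_ (trans (sumBy-cong (enum m) (λ u → w≡1 t u []))
                                (trans (sumBy-const 1 (enum m)) (ℕ.*-identityʳ (count m))))
                         (sumBy-cong (enum m) (prepended t)))

    internal-rec : ∀ n → internal n ≡ (count ⋆ remainders) n
    internal-rec n =
      trans (sumBy-enum isInternal n)
            (cong₂ _+_ (no-internal-leaf n) (count-internalTrees isInternal (λ _ _ _ → refl) n))
      where
      no-internal-leaf : ∀ n → sumBy isInternal (leafOfSize n) ≡ 0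
      no-internal-leaf 0             = refl
      no-internal-leaf 1             = refl
      no-internal-leaf (suc (suc n)) = refl

    count-rec : ∀ n → count n ≡ length (leafOfSize n) + internal n
    count-rec n = begin
      length (enum n)           ≡⟨ ℕ.*-identityʳ (length (enum n)) ⟨
      length (enum n) * 1       ≡⟨ sumBy-const 1 (enum n) ⟨
      sumBy (λ _ → 1) (enum n)  ≡⟨ sumBy-enum (λ _ → 1) n ⟩
      sumBy (λ _ → 1) (leafOfSize n) + sumBy (λ _ → 1) (internalTrees n)
        ≡⟨ cong₂ _+_ (trans (sumBy-const 1 (leafOfSize n)) (ℕ.*-identityʳ _))
                     (trans (count-internalTrees (λ _ → 1) (λ _ _ _ → refl) n) (sym (internal-rec n))) ⟩
      length (leafOfSize n) + internal n ∎
      where open ≡-Reasoning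

    module WithLeafCount (k : ℕ) where

      hasK : ℕ → ℕ
      hasK n = if does (n ℕ.≟ k) then 1 else 0

      nonRoot : Tree → ℕ
      nonRoot z = countKF k (children z)

      vertices : ℕ → ℕ
      vertices n = sumBy (countK k) (enum n)

      nonRootVertices : ℕ → ℕ
      nonRootVertices n = sumBy nonRoot (enum n)

      roots : ℕ → ℕ
      roots n = count n * hasK n

      remainderVertices : ℕ → ℕ
      remainderVertices m = vertices m + nonRootVertices m

      vertices-rec : ∀ n → vertices n ≡ roots n + nonRootVertices n
      vertices-rec n =
        trans (sumBy-cong-∈ (enum n) root-or-not)
              (trans (sumBy-+ (λ _ → hasK n) nonRoot (enum n))
                     (cong (_+ nonRootVertices n) (sumBy-const (hasK n) (enum n))))
        where
        root-or-not : ∀ {z} → z ∈ enum n → countK k z ≡ hasK n + nonRoot z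
        root-or-not {node ts} z∈ = cong (λ l → hasK l + countKF k ts) (proj₂ (∈enum⁻ z∈))

      nonRoot-withFirstChild : ∀ m t → sumBy nonRoot (withFirstChild m t) ≡
                               countK k t * remainders m + remainderVertices m
      nonRoot-withFirstChild m t = begin
        sumBy nonRoot (withFirstChild m t)
          ≡⟨ sumBy-withFirstChild nonRoot m t ⟩
        sumBy (λ u → countK k t + (countK k u + 0)) (enum m) +
        sumBy (sumBy nonRoot ∘ prependChild t) (enum m)
          ≡⟨ cong₂ _+_ two-children prepended ⟩
        (count m * countK k t + vertices m) + (internal m * countK k t + nonRootVertices m)
          ≡⟨ regroup (countK k t) (count m) (vertices m) (internal m) (nonRootVertices m) ⟩
        countK k t * remainders m + remainderVertices m ∎
        where
        open ≡-Reasoning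
        two-children : sumBy (λ u → countK k t + (countK k u + 0)) (enum m) ≡
                       count m * countK k t + vertices m
        two-children =
          trans (sumBy-cong (enum m) (λ u → cong (countK k t +_) (ℕ.+-identityʳ (countK k u))))
                (trans (sumBy-+ (λ _ → countK k t) (countK k) (enum m))
                       (cong (_+ vertices m) (sumBy-const (countK k t) (enum m))))
        prependedᵥ : ∀ v → sumBy nonRoot (prependChild t v) ≡ isInternal v * countK k t + nonRoot v
        prependedᵥ (node [])       = refl
        prependedᵥ (node (u ∷ us)) =
          trans (ℕ.+-identityʳ _) (cong (_+ countKF k (u ∷ us)) (sym (ℕ.*-identityˡ (countK k t))))
        prepended : sumBy (sumBy nonRoot ∘ prependChild t) (enum m) ≡
                    internal m * countK k t + nonRootVertices m
        prepended =
          trans (sumBy-cong (enum m) prependedᵥ)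
                (trans (sumBy-+ (λ v → isInternal v * countK k t) nonRoot (enum m))
                       (cong (_+ nonRootVertices m) (sumBy-*ʳ isInternal (countK k t) (enum m))))
        regroup : ∀ a b c d e → (b * a + c) + (d * a + e) ≡ a * (b + d) + (c + e)
        regroup = solve-∀

      nonRootVertices-rec : ∀ n → nonRootVertices n ≡
                            (vertices ⋆ remainders) n + (count ⋆ remainderVertices) n
      nonRootVertices-rec n = begin
        nonRootVertices n
          ≡⟨ sumBy-enum nonRoot n ⟩
        sumBy nonRoot (leafOfSize n) + sumBy nonRoot (internalTrees n)
          ≡⟨ cong₂ _+_ (no-leaf-children n) (sumBy-internalTrees nonRoot n) ⟩
        sumBy (λ i → sumBy (sumBy nonRoot ∘ withFirstChild (n ∸ i)) (enum i)) (upTo (suc n))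
          ≡⟨ sumBy-cong (upTo (suc n)) by-first-child ⟩
        sumBy (λ i → vertices i * remainders (n ∸ i) + count i * remainderVertices (n ∸ i)) (upTo (suc n))
          ≡⟨ sumBy-+ (λ i → vertices i * remainders (n ∸ i))
                     (λ i → count i * remainderVertices (n ∸ i)) (upTo (suc n)) ⟩
        (vertices ⋆ remainders) n + (count ⋆ remainderVertices) n ∎
        where
        open ≡-Reasoning
        no-leaf-children : ∀ n → sumBy nonRoot (leafOfSize n) ≡ 0
        no-leaf-children 0             = refl
        no-leaf-children 1             = refl
        no-leaf-children (suc (suc n)) = refl
        by-first-child : ∀ i → sumBy (sumBy nonRoot ∘ withFirstChild (n ∸ i)) (enum i) ≡
                         vertices i * remainders (n ∸ i) + count i * remainderVertices (n ∸ i)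
        by-first-child i =
          trans (sumBy-cong (enum i) (nonRoot-withFirstChild (n ∸ i)))
                (trans (sumBy-+ (λ t → countK k t * remainders (n ∸ i))
                                (λ _ → remainderVertices (n ∸ i)) (enum i))
                       (cong₂ _+_ (sumBy-*ʳ (countK k) (remainders (n ∸ i)) (enum i))
                                  (sumBy-const (remainderVertices (n ∸ i)) (enum i))))

      roots≡filter : ∀ n → length (filter (λ t → leaves t ℕ.≟ k) (enum n)) ≡ roots n
      roots≡filter n with n ℕ.≟ k
      ... | yes n≡k =
        trans (cong length (List.filter-all (λ t → leaves t ℕ.≟ k)
                              (All.tabulate (λ z∈ → trans (proj₂ (∈enum⁻ z∈)) n≡k))))
              (trans (sym (ℕ.*-identityʳ (count n)))
                     (cong (λ b → count n * (if b then 1 else 0)) (sym (dec-true (n ℕ.≟ k) n≡k))))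
      ... | no n≢k =
        trans (cong length (List.filter-none (λ t → leaves t ℕ.≟ k)
                              (All.tabulate (λ z∈ l≡k → n≢k (trans (sym (proj₂ (∈enum⁻ z∈))) l≡k)))))
              (trans (sym (ℕ.*-zeroʳ (count n)))
                     (cong (λ b → count n * (if b then 1 else 0)) (sym (dec-false (n ℕ.≟ k) n≢k))))

module Rationals where

  open import Data.Nat as ℕ using (ℕ)
  open import Data.Integer as ℤ using (+_; 1ℤ)
  import Data.Integer.Properties as ℤ
  import Data.Integer.Tactic.RingSolver as ℤ-Solver
  open import Data.Rational using (0ℚ; _+_; _*_)
  open import Data.Rational.Literals using (fromℤ)
  open import Data.Rational.Properties
    using (_≟_; +-*-commutativeRing; normalize-coprime; toℚᵘ-injective; toℚᵘ-homo-+;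
           toℚᵘ-homo-*)
  open import Data.Rational.Unnormalised using (*≡*)
  open import Data.Rational.Unnormalised.Properties using (≃-sym; ≃-trans)
  import Data.Nat.Coprimality as Coprime
  open import Relation.Binary.PropositionalEquality
  open import Relation.Nullary.Decidable.Core using (dec⇒maybe)
  open import Tactic.RingSolver.Core.AlmostCommutativeRing
    using (AlmostCommutativeRing; fromCommutativeRing)

  ℚ-ring : AlmostCommutativeRing _ _
  ℚ-ring = fromCommutativeRing +-*-commutativeRing λ x → dec⇒maybe (0ℚ ≟ x)

  ℕtoℚ≡fromℤ : ∀ m → ℕtoℚ m ≡ fromℤ (+ m)
  ℕtoℚ≡fromℤ m = normalize-coprime (Coprime.sym (Coprime.1-coprimeTo m))

  ℕtoℚ-+ : ∀ m n → ℕtoℚ (m ℕ.+ n) ≡ ℕtoℚ m + ℕtoℚ n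
  ℕtoℚ-+ m n rewrite ℕtoℚ≡fromℤ (m ℕ.+ n) | ℕtoℚ≡fromℤ m | ℕtoℚ≡fromℤ n =
    toℚᵘ-injective (≃-sym (≃-trans (toℚᵘ-homo-+ (fromℤ (+ m)) (fromℤ (+ n))) (*≡* cross)))
    where
    unit : ∀ x y → (x ℤ.* 1ℤ ℤ.+ y ℤ.* 1ℤ) ℤ.* 1ℤ ≡ (x ℤ.+ y) ℤ.* 1ℤ
    unit = ℤ-Solver.solve-∀
    cross : (+ m ℤ.* 1ℤ ℤ.+ + n ℤ.* 1ℤ) ℤ.* 1ℤ ≡ + (m ℕ.+ n) ℤ.* 1ℤ
    cross = trans (unit (+ m) (+ n)) (cong (ℤ._* 1ℤ) (sym (ℤ.pos-+ m n)))

  ℕtoℚ-* : ∀ m n → ℕtoℚ (m ℕ.* n) ≡ ℕtoℚ m * ℕtoℚ n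
  ℕtoℚ-* m n rewrite ℕtoℚ≡fromℤ (m ℕ.* n) | ℕtoℚ≡fromℤ m | ℕtoℚ≡fromℤ n =
    toℚᵘ-injective (≃-sym (≃-trans (toℚᵘ-homo-* (fromℤ (+ m)) (fromℤ (+ n))) (*≡* cross)))
    where
    cross : (+ m ℤ.* + n) ℤ.* 1ℤ ≡ + (m ℕ.* n) ℤ.* 1ℤ
    cross = cong (ℤ._* 1ℤ) (sym (ℤ.pos-* m n))

module PowerSeries where

  open import Algebra.Bundles using (CommutativeRing)
  open import Algebra.Structures using (IsCommutativeRing)
  import Algebra.Construct.Pointwise as Pointwise
  import Algebra.Properties.Group as GroupProperties
  import Algebra.Solver.Ring
  import Algebra.Solver.Ring.AlmostCommutativeRing as ACR
  open import Data.Nat as ℕ using (ℕ; zero; suc; _∸_; _≤_; z≤n)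
  import Data.Nat.Properties as ℕ
  open import Data.Rational as ℚ using (ℚ; 0ℚ; 1ℚ; _+_; _*_; -_)
  import Data.Rational.Properties as ℚ
  open import Data.List using ([]; _∷_; map; applyUpTo)
  import Data.Maybe as Maybe
  open import Data.Product using (_,_)
  open import Data.Sum using (inj₁; inj₂)
  open import Function using (_∘_; id)
  open import Relation.Binary.PropositionalEquality
  open import Relation.Nullary.Decidable.Core using (dec⇒maybe)
  open import Tactic.RingSolver using (solve-∀)
  open Rationals using (ℚ-ring)

  infix 4 _≈_
  _≈_ : FPS → FPS → Set
  f ≈ g = ∀ n → f n ≡ g n

  0ₛ : FPS
  0ₛ _ = 0ℚ

  ⊖_ : FPS → FPS
  (⊖ f) n = - f n

  scalar : ℚ → FPS
  scalar c = poly (c ∷ [])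

  X : FPS
  X = poly (0ℚ ∷ 1ℚ ∷ [])

  ∑ : ℕ → (ℕ → ℚ) → ℚ
  ∑ m h = sumℚ (applyUpTo h m)

  ∑-cong : ∀ m {h h′} → (∀ i → h i ≡ h′ i) → ∑ m h ≡ ∑ m h′
  ∑-cong zero    h≡h′ = refl
  ∑-cong (suc m) h≡h′ = cong₂ _+_ (h≡h′ 0) (∑-cong m (h≡h′ ∘ suc))

  ∑-zero : ∀ m → ∑ m (λ _ → 0ℚ) ≡ 0ℚ
  ∑-zero zero    = refl
  ∑-zero (suc m) = trans (ℚ.+-identityˡ _) (∑-zero m)

  ∑-+ : ∀ m h h′ → ∑ m (λ i → h i + h′ i) ≡ ∑ m h + ∑ m h′
  ∑-+ zero    h h′ = sym (ℚ.+-identityˡ 0ℚ)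
  ∑-+ (suc m) h h′ =
    trans (cong (h 0 + h′ 0 +_) (∑-+ m (h ∘ suc) (h′ ∘ suc)))
          (interchange (h 0) (h′ 0) (∑ m (h ∘ suc)) (∑ m (h′ ∘ suc)))
    where
    interchange : ∀ a b c d → a + b + (c + d) ≡ (a + c) + (b + d)
    interchange = solve-∀ ℚ-ring

  ∑-scale : ∀ m c h → ∑ m (λ i → c * h i) ≡ c * ∑ m h
  ∑-scale zero    c h = sym (ℚ.*-zeroʳ c)
  ∑-scale (suc m) c h =
    trans (cong (c * h 0 +_) (∑-scale m c (h ∘ suc)))
          (sym (ℚ.*-distribˡ-+ c (h 0) (∑ m (h ∘ suc))))

  map-applyUpTo : ∀ {A B : Set} (h : A → B) (f : ℕ → A) n →
                  map h (applyUpTo f n) ≡ applyUpTo (h ∘ f) n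
  map-applyUpTo h f zero    = refl
  map-applyUpTo h f (suc n) = cong (h (f 0) ∷_) (map-applyUpTo h (f ∘ suc) n)

  -- Unlike upTo, applyUpTo shifts the index, so that conv f g (suc n)
  -- unfolds to f 0 * g (suc n) + conv (f ∘ suc) g n.
  conv : FPS → FPS → FPS
  conv f g n = ∑ (suc n) (λ i → f i * g (n ∸ i))

  ⊛≈conv : ∀ f g → f ⊛ g ≈ conv f g
  ⊛≈conv f g n = cong sumℚ (map-applyUpTo (λ i → f i * g (n ∸ i)) id (suc n))

  conv-cong : ∀ {f f′ g g′} → f ≈ f′ → g ≈ g′ → conv f g ≈ conv f′ g′
  conv-cong f≈f′ g≈g′ n = ∑-cong (suc n) (λ i → cong₂ _*_ (f≈f′ i) (g≈g′ (n ∸ i)))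

  conv-zeroˡ : ∀ g n → conv 0ₛ g n ≡ 0ℚ
  conv-zeroˡ g n = trans (∑-cong (suc n) (λ i → ℚ.*-zeroˡ (g (n ∸ i)))) (∑-zero (suc n))

  conv-vanishʳ : ∀ f e n → (∀ i → i ≤ n → e i ≡ 0ℚ) → conv f e n ≡ 0ℚ
  conv-vanishʳ f e n e≡0 = trans (∑-cong (suc n) term≡0) (∑-zero (suc n))
    where
    term≡0 : ∀ i → f i * e (n ∸ i) ≡ 0ℚ
    term≡0 i = trans (cong (f i *_) (e≡0 (n ∸ i) (ℕ.m∸n≤m n i))) (ℚ.*-zeroʳ (f i))

  conv-+ˡ : ∀ f f′ g n → conv (f ⊕ f′) g n ≡ conv f g n + conv f′ g n
  conv-+ˡ f f′ g n =
    trans (∑-cong (suc n) (λ i → ℚ.*-distribʳ-+ (g (n ∸ i)) (f i) (f′ i)))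
          (∑-+ (suc n) (λ i → f i * g (n ∸ i)) (λ i → f′ i * g (n ∸ i)))

  conv-scaleˡ : ∀ c f g n → conv (λ m → c * f m) g n ≡ c * conv f g n
  conv-scaleˡ c f g n =
    trans (∑-cong (suc n) (λ i → ℚ.*-assoc c (f i) (g (n ∸ i))))
          (∑-scale (suc n) c (λ i → f i * g (n ∸ i)))

  conv-oneʳ : ∀ f n → conv f one n ≡ f n
  conv-oneʳ f zero    = trans (ℚ.+-identityʳ _) (ℚ.*-identityʳ (f 0))
  conv-oneʳ f (suc n) =
    trans (cong₂ _+_ (ℚ.*-zeroʳ (f 0)) (conv-oneʳ (f ∘ suc) n)) (ℚ.+-identityˡ _)

  conv-sucʳ : ∀ f g n → conv f g (suc n) ≡ conv f (g ∘ suc) n + f (suc n) * g 0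
  conv-sucʳ f g zero    = trans (cong (f 0 * g 1 +_) (ℚ.+-identityʳ (f 1 * g 0)))
                                (cong (_+ f 1 * g 0) (sym (ℚ.+-identityʳ (f 0 * g 1))))
  conv-sucʳ f g (suc n) =
    trans (cong (f 0 * g (suc (suc n)) +_) (conv-sucʳ (f ∘ suc) g n))
          (sym (ℚ.+-assoc (f 0 * g (suc (suc n))) (conv (f ∘ suc) (g ∘ suc) n)
                          (f (suc (suc n)) * g 0)))

  conv-comm : ∀ f g n → conv f g n ≡ conv g f n
  conv-comm f g zero    = cong (_+ 0ℚ) (ℚ.*-comm (f 0) (g 0))
  conv-comm f g (suc n) =
    trans (cong (f 0 * g (suc n) +_) (conv-comm (f ∘ suc) g n))
          (trans (ℚ.+-comm (f 0 * g (suc n)) (conv g (f ∘ suc) n))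
                 (trans (cong (conv g (f ∘ suc) n +_) (ℚ.*-comm (f 0) (g (suc n))))
                        (sym (conv-sucʳ g f n))))

  conv-assoc : ∀ f g h n → conv (conv f g) h n ≡ conv f (conv g h) n
  conv-assoc f g h zero    = ring (f 0) (g 0) (h 0)
    where ring : ∀ a b c → (a * b + 0ℚ) * c + 0ℚ ≡ a * (b * c + 0ℚ) + 0ℚ
          ring = solve-∀ ℚ-ring
  conv-assoc f g h (suc n) = begin
    conv f g 0 * h (suc n) + conv (λ m → f 0 * g (suc m) + conv (f ∘ suc) g m) h n
      ≡⟨ cong (conv f g 0 * h (suc n) +_) (conv-+ˡ (λ m → f 0 * g (suc m)) (conv (f ∘ suc) g) h n) ⟩
    conv f g 0 * h (suc n) + (conv (λ m → f 0 * g (suc m)) h n + conv (conv (f ∘ suc) g) h n)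
      ≡⟨ cong₂ (λ u v → conv f g 0 * h (suc n) + (u + v))
               (conv-scaleˡ (f 0) (g ∘ suc) h n) (conv-assoc (f ∘ suc) g h n) ⟩
    conv f g 0 * h (suc n) + (f 0 * conv (g ∘ suc) h n + conv (f ∘ suc) (conv g h) n)
      ≡⟨ ring (f 0) (g 0) (h (suc n)) _ _ ⟩
    f 0 * conv g h (suc n) + conv (f ∘ suc) (conv g h) n ∎
    where
    open ≡-Reasoning
    ring : ∀ a b c d e → (a * b + 0ℚ) * c + (a * d + e) ≡ a * (b * c + d) + e
    ring = solve-∀ ℚ-ring

  ⊛-cong : ∀ {f f′ g g′} → f ≈ f′ → g ≈ g′ → f ⊛ g ≈ f′ ⊛ g′
  ⊛-cong {f} {f′} {g} {g′} f≈f′ g≈g′ n =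
    trans (⊛≈conv f g n) (trans (conv-cong f≈f′ g≈g′ n) (sym (⊛≈conv f′ g′ n)))

  ⊛-comm : ∀ f g → f ⊛ g ≈ g ⊛ f
  ⊛-comm f g n = trans (⊛≈conv f g n) (trans (conv-comm f g n) (sym (⊛≈conv g f n)))

  ⊛-assoc : ∀ f g h → (f ⊛ g) ⊛ h ≈ f ⊛ (g ⊛ h)
  ⊛-assoc f g h n = begin
    ((f ⊛ g) ⊛ h) n      ≡⟨ ⊛≈conv (f ⊛ g) h n ⟩
    conv (f ⊛ g) h n     ≡⟨ conv-cong {g = h} (⊛≈conv f g) (λ _ → refl) n ⟩
    conv (conv f g) h n  ≡⟨ conv-assoc f g h n ⟩
    conv f (conv g h) n  ≡⟨ conv-cong {f = f} (λ _ → refl) (λ m → sym (⊛≈conv g h m)) n ⟩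
    conv f (g ⊛ h) n     ≡⟨ ⊛≈conv f (g ⊛ h) n ⟨
    (f ⊛ (g ⊛ h)) n      ∎
    where open ≡-Reasoning

  ⊛-identityʳ : ∀ f → f ⊛ one ≈ f
  ⊛-identityʳ f n = trans (⊛≈conv f one n) (conv-oneʳ f n)

  ⊛-identityˡ : ∀ f → one ⊛ f ≈ f
  ⊛-identityˡ f n = trans (⊛-comm one f n) (⊛-identityʳ f n)

  ⊛-distribʳ : ∀ h f g → (f ⊕ g) ⊛ h ≈ (f ⊛ h) ⊕ (g ⊛ h)
  ⊛-distribʳ h f g n =
    trans (⊛≈conv (f ⊕ g) h n)
          (trans (conv-+ˡ f g h n) (sym (cong₂ _+_ (⊛≈conv f h n) (⊛≈conv g h n))))

  ⊛-distribˡ : ∀ h f g → h ⊛ (f ⊕ g) ≈ (h ⊛ f) ⊕ (h ⊛ g)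
  ⊛-distribˡ h f g n =
    trans (⊛-comm h (f ⊕ g) n)
          (trans (⊛-distribʳ h f g n) (cong₂ _+_ (⊛-comm f h n) (⊛-comm g h n)))

  ⊛-isCommutativeRing : IsCommutativeRing _≈_ _⊕_ _⊛_ ⊖_ 0ₛ one
  ⊛-isCommutativeRing = record
    { isRing = record
      { +-isAbelianGroup = Pointwise.isAbelianGroup ℕ ℚ.+-0-isAbelianGroup
      ; *-cong           = ⊛-cong
      ; *-assoc          = ⊛-assoc
      ; *-identity       = ⊛-identityˡ , ⊛-identityʳ
      ; distrib          = ⊛-distribˡ , ⊛-distribʳ
      }
    ; *-comm = ⊛-comm
    }

  ⊛-commutativeRing : CommutativeRing _ _
  ⊛-commutativeRing = record { isCommutativeRing = ⊛-isCommutativeRing }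

  scalar-⊛ : ∀ c f → scalar c ⊛ f ≈ (λ n → c * f n)
  scalar-⊛ c f zero    = ℚ.+-identityʳ (c * f 0)
  scalar-⊛ c f (suc n) =
    trans (⊛≈conv (scalar c) f (suc n))
          (trans (cong (c * f (suc n) +_) (conv-zeroˡ f n)) (ℚ.+-identityʳ (c * f (suc n))))

  scalar-homomorphism : CommutativeRing.rawRing ℚ.+-*-commutativeRing
                        ACR.-Raw-AlmostCommutative⟶ ACR.fromCommutativeRing ⊛-commutativeRing
  scalar-homomorphism = record
    { ⟦_⟧    = scalar
    ; +-homo = λ { a b zero → refl ; a b (suc n) → sym (ℚ.+-identityˡ 0ℚ) }
    ; *-homo = λ a b n → sym (trans (scalar-⊛ a (scalar b) n) (product a b n))
    ; -‿homo = λ { a zero → refl ; a (suc n) → refl }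
    ; 0-homo = λ { zero → refl ; (suc n) → refl }
    ; 1-homo = λ { zero → refl ; (suc n) → refl }
    }
    where
    product : ∀ a b n → a * scalar b n ≡ scalar (a * b) n
    product a b zero    = refl
    product a b (suc n) = ℚ.*-zeroʳ a

  scalar-≟ : ∀ a b → Maybe.Maybe (scalar a ≈ scalar b)
  scalar-≟ a b = Maybe.map (λ a≡b n → cong (λ c → scalar c n) a≡b) (dec⇒maybe (a ℚ.≟ b))

  module ⊛-Solver = Algebra.Solver.Ring
    (CommutativeRing.rawRing ℚ.+-*-commutativeRing)
    (ACR.fromCommutativeRing ⊛-commutativeRing) scalar-homomorphism scalar-≟

  private
    module ⊛ = CommutativeRing ⊛-commutativeRing
    open ⊛-Solver using (solve; _:=_; _:+_; _:-_; _:*_)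

  open GroupProperties ⊛.+-group using (x∙y⁻¹≈ε⇒x≈y)

  ⊛-cancelʳ-0ₛ : ∀ {e p} (c : ℚ) → c * p 0 ≡ 1ℚ → e ⊛ p ≈ 0ₛ → e ≈ 0ₛ
  ⊛-cancelʳ-0ₛ {e} {p} c c*p₀≡1 e⊛p≈0 n = vanishes n n ℕ.≤-refl
    where
    open ≡-Reasoning
    p₀-cancel : ∀ {y} → p 0 * y ≡ 0ℚ → y ≡ 0ℚ
    p₀-cancel {y} p₀*y≡0 = begin
      y             ≡⟨ ℚ.*-identityˡ y ⟨
      1ℚ * y        ≡⟨ cong (_* y) c*p₀≡1 ⟨
      c * p 0 * y   ≡⟨ ℚ.*-assoc c (p 0) y ⟩
      c * (p 0 * y) ≡⟨ cong (c *_) p₀*y≡0 ⟩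
      c * 0ℚ        ≡⟨ ℚ.*-zeroʳ c ⟩
      0ℚ            ∎
    conv-p-e≡0 : ∀ m → conv p e m ≡ 0ℚ
    conv-p-e≡0 m = trans (conv-comm p e m) (trans (sym (⊛≈conv e p m)) (e⊛p≈0 m))
    vanishes : ∀ m i → i ≤ m → e i ≡ 0ℚ
    vanishes zero    .zero z≤n = p₀-cancel (trans (sym (ℚ.+-identityʳ (p 0 * e 0))) (conv-p-e≡0 0))
    vanishes (suc m) i    i≤1+m with ℕ.m≤n⇒m<n∨m≡n i≤1+m
    ... | inj₁ i<1+m = vanishes m i (ℕ.≤-pred i<1+m)
    ... | inj₂ refl  = p₀-cancel (begin
      p 0 * e (suc m)      ≡⟨ ℚ.+-identityʳ (p 0 * e (suc m)) ⟨
      p 0 * e (suc m) + 0ℚ ≡⟨ cong (p 0 * e (suc m) +_) (conv-vanishʳ (p ∘ suc) e m (vanishes m)) ⟨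
      conv p e (suc m)     ≡⟨ conv-p-e≡0 (suc m) ⟩
      0ℚ                   ∎)

  ⊛-cancelʳ : ∀ {y z p} (c : ℚ) → c * p 0 ≡ 1ℚ → y ⊛ p ≈ z ⊛ p → y ≈ z
  ⊛-cancelʳ {y} {z} {p} c c*p₀≡1 y⊛p≈z⊛p = x∙y⁻¹≈ε⇒x≈y y z (⊛-cancelʳ-0ₛ c c*p₀≡1 (begin
    (y ⊕ (⊖ z)) ⊛ p        ≈⟨ distrib y z p ⟩
    (y ⊛ p) ⊕ (⊖ (z ⊛ p))  ≈⟨ ⊛.+-cong y⊛p≈z⊛p ⊛.refl ⟩
    (z ⊛ p) ⊕ (⊖ (z ⊛ p))  ≈⟨ ⊛.-‿inverseʳ (z ⊛ p) ⟩
    0ₛ                     ∎))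
    where
    open import Relation.Binary.Reasoning.Setoid ⊛.setoid
    distrib : ∀ y z p → (y ⊕ (⊖ z)) ⊛ p ≈ (y ⊛ p) ⊕ (⊖ (z ⊛ p))
    distrib = solve 3 (λ y z p → (y :- z) :* p := y :* p :- z :* p) ⊛.refl

  sqrt-unique : ∀ {s r} (c : ℚ) → c * (s 0 + r 0) ≡ 1ℚ → s ⊛ s ≈ r ⊛ r → s ≈ r
  sqrt-unique {s} {r} c c-inverts-s₀+r₀ s²≈r² =
    x∙y⁻¹≈ε⇒x≈y s r (⊛-cancelʳ-0ₛ {p = s ⊕ r} c c-inverts-s₀+r₀ (begin
      (s ⊕ (⊖ r)) ⊛ (s ⊕ r)  ≈⟨ difference-of-squares s r ⟩
      (s ⊛ s) ⊕ (⊖ (r ⊛ r))  ≈⟨ ⊛.+-cong s²≈r² ⊛.refl ⟩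
      (r ⊛ r) ⊕ (⊖ (r ⊛ r))  ≈⟨ ⊛.-‿inverseʳ (r ⊛ r) ⟩
      0ₛ                     ∎))
    where
    open import Relation.Binary.Reasoning.Setoid ⊛.setoid
    difference-of-squares : ∀ s r → (s ⊕ (⊖ r)) ⊛ (s ⊕ r) ≈ (s ⊛ s) ⊕ (⊖ (r ⊛ r))
    difference-of-squares = solve 2 (λ s r → (s :- r) :* (s :+ r) := s :* s :- r :* r) ⊛.refl

  ⊕-difference : ∀ {u v} e w → u ≈ v → e ⊕ (w ⊛ (u ⊕ (⊖ v))) ≈ e
  ⊕-difference {u} {v} e w u≈v = begin
    e ⊕ (w ⊛ (u ⊕ (⊖ v)))
      ≈⟨ ⊛.+-cong (⊛.refl {e}) (⊛.*-cong (⊛.refl {w}) (⊛.+-cong u≈v (⊛.refl {⊖ v}))) ⟩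
    e ⊕ (w ⊛ (v ⊕ (⊖ v)))  ≈⟨ vanish e w v ⟩
    e                      ∎
    where
    open import Relation.Binary.Reasoning.Setoid ⊛.setoid
    vanish : ∀ e w v → e ⊕ (w ⊛ (v ⊕ (⊖ v))) ≈ e
    vanish = solve 3 (λ e w v → e :+ w :* (v :- v) := e) ⊛.refl

  X⊛X : X ⊛ X ≈ poly (0ℚ ∷ 0ℚ ∷ 1ℚ ∷ [])
  X⊛X zero    = refl
  X⊛X (suc n) =
    trans (⊛≈conv X X (suc n))
          (trans (cong₂ _+_ (ℚ.*-zeroˡ (X (suc n))) (trans (conv-comm one X n) (conv-oneʳ X n)))
                 (ℚ.+-identityˡ (X n)))

  disc≈ : disc ≈ (one ⊕ (scalar (- ℕtoℚ 6) ⊛ X)) ⊕ (X ⊛ X)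
  disc≈ n =
    sym (trans (cong₂ _+_ (cong (one n +_) (scalar-⊛ (- ℕtoℚ 6) X n)) (X⊛X n)) (coefficient n))
    where
    coefficient : ∀ n → one n + (- ℕtoℚ 6) * X n + poly (0ℚ ∷ 0ℚ ∷ 1ℚ ∷ []) n ≡ disc n
    coefficient 0                   = refl
    coefficient 1                   = refl
    coefficient 2                   = refl
    coefficient (suc (suc (suc n))) = refl

  threeMinusX≈ : threeMinusX ≈ scalar (ℕtoℚ 3) ⊕ (⊖ X)
  threeMinusX≈ 0             = refl
  threeMinusX≈ 1             = refl
  threeMinusX≈ (suc (suc n)) = refl

open PowerSeries

module FunctionalEquations
  {a ν g h l : FPS}
  (a-eq : a ≈ X ⊕ ν) (ν-eq : ν ≈ a ⊛ (a ⊕ ν))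
  (g-eq : g ≈ l ⊕ h) (h-eq : h ≈ (g ⊛ (a ⊕ ν)) ⊕ (a ⊛ (g ⊕ h)))
  where

  open import Algebra.Bundles using (CommutativeRing)
  open import Data.Integer using (+_)
  open import Data.Product using (_,_)
  open import Data.Rational as ℚ using (0ℚ; 1ℚ; ½; _+_; _*_; -_)
  open import Relation.Binary.PropositionalEquality using (_≡_; refl; trans; cong; cong₂)
  open ⊛-Solver using (solve; _:=_; _:+_; _:-_; _:*_; con)
  private module ⊛ = CommutativeRing ⊛-commutativeRing
  open import Relation.Binary.Reasoning.Setoid ⊛.setoid

  root : FPS
  root = (one ⊕ X) ⊕ (⊖ (four ⊛ a))

  difference-eq : ∀ {u v w} → u ≈ v ⊕ w → w ≈ u ⊕ (⊖ v)
  difference-eq {u} {v} {w} u≈v+w = begin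
    w                    ≈⟨ cancel v w ⟩
    (v ⊕ w) ⊕ (⊖ v)      ≈⟨ ⊛.+-cong (⊛.sym u≈v+w) (⊛.refl {⊖ v}) ⟩
    u ⊕ (⊖ v)            ∎
    where
    cancel : ∀ v w → w ≈ (v ⊕ w) ⊕ (⊖ v)
    cancel = solve 2 (λ v w → w := (v :+ w) :- v) ⊛.refl

  a-equation : a ≈ X ⊕ (a ⊛ (a ⊕ (a ⊕ (⊖ X))))
  a-equation = ⊛.trans a-eq (⊛.+-cong (⊛.refl {X})
    (⊛.trans ν-eq (⊛.*-cong (⊛.refl {a}) (⊛.+-cong (⊛.refl {a}) (difference-eq a-eq)))))

  g-equation : g ⊕ (⊖ l) ≈ (g ⊛ (a ⊕ (a ⊕ (⊖ X)))) ⊕ (a ⊛ (g ⊕ (g ⊕ (⊖ l))))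
  g-equation = ⊛.trans (⊛.sym (difference-eq g-eq)) (⊛.trans h-eq (⊛.+-cong
    (⊛.*-cong (⊛.refl {g}) (⊛.+-cong (⊛.refl {a}) (difference-eq a-eq)))
    (⊛.*-cong (⊛.refl {a}) (⊛.+-cong (⊛.refl {g}) (difference-eq g-eq)))))

  root-squared : root ⊛ root ≈ disc
  root-squared = begin
    root ⊛ root
      ≈⟨ expand a X ⟩
    D ⊕ (scalar (ℕtoℚ 8) ⊛ ((X ⊕ (a ⊛ (a ⊕ (a ⊕ (⊖ X))))) ⊕ (⊖ a)))
      ≈⟨ ⊕-difference D (scalar (ℕtoℚ 8)) (⊛.sym a-equation) ⟩
    D
      ≈⟨ ⊛.sym disc≈ ⟩
    disc ∎
    where
    D : FPS
    D = (one ⊕ (scalar (- ℕtoℚ 6) ⊛ X)) ⊕ (X ⊛ X)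
    expand : ∀ a x →
      ((one ⊕ x) ⊕ (⊖ (four ⊛ a))) ⊛ ((one ⊕ x) ⊕ (⊖ (four ⊛ a))) ≈
      ((one ⊕ (scalar (- ℕtoℚ 6) ⊛ x)) ⊕ (x ⊛ x)) ⊕
        (scalar (ℕtoℚ 8) ⊛ ((x ⊕ (a ⊛ (a ⊕ (a ⊕ (⊖ x))))) ⊕ (⊖ a)))
    expand = solve 2 (λ a x →
      ((con 1ℚ :+ x) :- con (ℕtoℚ 4) :* a) :* ((con 1ℚ :+ x) :- con (ℕtoℚ 4) :* a) :=
      ((con 1ℚ :+ con (- ℕtoℚ 6) :* x) :+ x :* x) :+
        con (ℕtoℚ 8) :* ((x :+ a :* (a :+ (a :- x))) :- a))
      ⊛.refl

  g⊛root : g ⊛ root ≈ l ⊛ (one ⊕ (⊖ a))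
  g⊛root = begin
    g ⊛ root
      ≈⟨ expand g l a X ⟩
    (l ⊛ (one ⊕ (⊖ a))) ⊕ (one ⊛ ((g ⊕ (⊖ l)) ⊕ (⊖ W)))
      ≈⟨ ⊕-difference (l ⊛ (one ⊕ (⊖ a))) one g-equation ⟩
    l ⊛ (one ⊕ (⊖ a)) ∎
    where
    W : FPS
    W = (g ⊛ (a ⊕ (a ⊕ (⊖ X)))) ⊕ (a ⊛ (g ⊕ (g ⊕ (⊖ l))))
    expand : ∀ g l a x →
      g ⊛ ((one ⊕ x) ⊕ (⊖ (four ⊛ a))) ≈
      (l ⊛ (one ⊕ (⊖ a))) ⊕
        (one ⊛ ((g ⊕ (⊖ l)) ⊕ (⊖ ((g ⊛ (a ⊕ (a ⊕ (⊖ x)))) ⊕ (a ⊛ (g ⊕ (g ⊕ (⊖ l))))))))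
    expand = solve 4 (λ g l a x →
      g :* ((con 1ℚ :+ x) :- con (ℕtoℚ 4) :* a) :=
      l :* (con 1ℚ :- a) :+
        con 1ℚ :* ((g :- l) :- (g :* (a :+ (a :- x)) :+ a :* (g :+ (g :- l)))))
      ⊛.refl

  solution : ∀ {S U} → a 0 ≡ 0ℚ → IsSqrt S disc → IsInverse U (four ⊛ S) →
             g ≈ (l ⊛ (threeMinusX ⊕ S)) ⊛ U
  solution {S} {U} a₀≡0 (S₀≡1 , S²≈disc) U⊛4S≈1 =
    ⊛.sym (⊛-cancelʳ {p = four ⊛ S} (+ 1 ℚ./ 4) ¼*4S₀≡1 (begin
      ((l ⊛ (threeMinusX ⊕ S)) ⊛ U) ⊛ (four ⊛ S)
        ≈⟨ ⊛.*-assoc (l ⊛ (threeMinusX ⊕ S)) U (four ⊛ S) ⟩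
      (l ⊛ (threeMinusX ⊕ S)) ⊛ (U ⊛ (four ⊛ S))
        ≈⟨ ⊛.*-cong (⊛.refl {l ⊛ (threeMinusX ⊕ S)}) U⊛4S≈1 ⟩
      (l ⊛ (threeMinusX ⊕ S)) ⊛ one
        ≈⟨ ⊛.*-identityʳ (l ⊛ (threeMinusX ⊕ S)) ⟩
      l ⊛ (threeMinusX ⊕ S)
        ≈⟨ ⊛.*-cong (⊛.refl {l}) (⊛.+-cong threeMinusX≈ S≈root) ⟩
      l ⊛ ((scalar (ℕtoℚ 3) ⊕ (⊖ X)) ⊕ root)
        ≈⟨ regroup l a X ⟩
      four ⊛ (l ⊛ (one ⊕ (⊖ a)))
        ≈⟨ ⊛.*-cong (⊛.refl {four}) g⊛root ⟨
      four ⊛ (g ⊛ root)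
        ≈⟨ swap g root ⟩
      g ⊛ (four ⊛ root)
        ≈⟨ ⊛.*-cong (⊛.refl {g}) (⊛.*-cong (⊛.refl {four}) S≈root) ⟨
      g ⊛ (four ⊛ S) ∎))
    where
    ½-inverts-S₀+root₀ : ½ * (S 0 + root 0) ≡ 1ℚ
    ½-inverts-S₀+root₀ =
      trans (cong₂ (λ s a₀ → ½ * (s + ((1ℚ + 0ℚ) + - (ℕtoℚ 4 * a₀ + 0ℚ)))) S₀≡1 a₀≡0) refl
    S≈root : S ≈ root
    S≈root = sqrt-unique ½ ½-inverts-S₀+root₀ (⊛.trans S²≈disc (⊛.sym root-squared))
    ¼*4S₀≡1 : (+ 1 ℚ./ 4) * (four ⊛ S) 0 ≡ 1ℚ
    ¼*4S₀≡1 = trans (cong (λ s → (+ 1 ℚ./ 4) * (ℕtoℚ 4 * s + 0ℚ)) S₀≡1) refl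
    regroup : ∀ l a x →
      l ⊛ ((scalar (ℕtoℚ 3) ⊕ (⊖ x)) ⊕ ((one ⊕ x) ⊕ (⊖ (four ⊛ a)))) ≈
      four ⊛ (l ⊛ (one ⊕ (⊖ a)))
    regroup = solve 3 (λ l a x →
      l :* ((con (ℕtoℚ 3) :- x) :+ ((con 1ℚ :+ x) :- con (ℕtoℚ 4) :* a)) :=
      con (ℕtoℚ 4) :* (l :* (con 1ℚ :- a)))
      ⊛.refl
    swap : ∀ g r → four ⊛ (g ⊛ r) ≈ g ⊛ (four ⊛ r)
    swap = solve 2 (λ g r → con (ℕtoℚ 4) :* (g :* r) := g :* (con (ℕtoℚ 4) :* r)) ⊛.refl

module GeneratingFunctions where

  open TreeCounting
  open import Data.Nat as ℕ using (ℕ; zero; suc)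
  open import Data.List as List using (List; []; _∷_; map; length)
  import Data.List.Properties as List
  open import Data.Rational using (0ℚ; _+_)
  open import Function using (_∘_)
  open import Relation.Binary.PropositionalEquality
  open Rationals using (ℕtoℚ-+; ℕtoℚ-*)

  series : (ℕ → ℕ) → FPS
  series f n = ℕtoℚ (f n)

  series-+ : ∀ f h → series (λ m → f m ℕ.+ h m) ≈ series f ⊕ series h
  series-+ f h n = ℕtoℚ-+ (f n) (h n)

  ℕtoℚ-sumBy : ∀ {A : Set} (w : A → ℕ) xs → ℕtoℚ (sumBy w xs) ≡ sumℚ (map (ℕtoℚ ∘ w) xs)
  ℕtoℚ-sumBy w []       = refl
  ℕtoℚ-sumBy w (x ∷ xs) =
    trans (ℕtoℚ-+ (w x) (sumBy w xs)) (cong (ℕtoℚ (w x) +_) (ℕtoℚ-sumBy w xs))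

  series-⋆ : ∀ f h → series (f ⋆ h) ≈ series f ⊛ series h
  series-⋆ f h n =
    trans (ℕtoℚ-sumBy (λ i → f i ℕ.* h (n ℕ.∸ i)) (List.upTo (suc n)))
          (cong sumℚ (List.map-cong (λ i → ℕtoℚ-* (f i) (h (n ℕ.∸ i))) (List.upTo (suc n))))

  series-⋆-+ : ∀ f h h′ → series (f ⋆ (λ m → h m ℕ.+ h′ m)) ≈ series f ⊛ (series h ⊕ series h′)
  series-⋆-+ f h h′ n =
    trans (series-⋆ f (λ m → h m ℕ.+ h′ m) n)
          (⊛-cong {f = series f} (λ _ → refl) (series-+ h h′) n)

  module Equations (enum : ℕ → List Tree) (isEnum : IsEnumeration enum) (k : ℕ) where

    open Decomposition enum isEnum
    open WithLeafCount k

    count-eq : series count ≈ X ⊕ series internal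
    count-eq n =
      trans (cong ℕtoℚ (count-rec n))
            (trans (ℕtoℚ-+ (length (leafOfSize n)) (internal n))
                   (cong (_+ series internal n) (leaf≡X n)))
      where
      leaf≡X : ∀ n → ℕtoℚ (length (leafOfSize n)) ≡ X n
      leaf≡X 0             = refl
      leaf≡X 1             = refl
      leaf≡X (suc (suc n)) = refl

    internal-eq : series internal ≈ series count ⊛ (series count ⊕ series internal)
    internal-eq n = trans (cong ℕtoℚ (internal-rec n)) (series-⋆-+ count count internal n)

    vertices-eq : series vertices ≈ L enum k ⊕ series nonRootVertices
    vertices-eq n =
      trans (cong ℕtoℚ (vertices-rec n))
            (trans (ℕtoℚ-+ (roots n) (nonRootVertices n))
                   (cong (_+ series nonRootVertices n) (cong ℕtoℚ (sym (roots≡filter n)))))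

    nonRootVertices-eq : series nonRootVertices ≈
      (series vertices ⊛ (series count ⊕ series internal)) ⊕
      (series count ⊛ (series vertices ⊕ series nonRootVertices))
    nonRootVertices-eq n =
      trans (cong ℕtoℚ (nonRootVertices-rec n))
            (trans (ℕtoℚ-+ ((vertices ⋆ remainders) n) ((count ⋆ remainderVertices) n))
                   (cong₂ _+_ (series-⋆-+ vertices count internal n)
                              (series-⋆-+ count vertices nonRootVertices n)))

    count-0 : series count 0 ≡ 0ℚ
    count-0 = cong (ℕtoℚ ∘ length) enum-0

    G≈series-vertices : G enum k ≈ series vertices
    G≈series-vertices zero    = cong (ℕtoℚ ∘ sumBy (countK k)) (sym enum-0)
    G≈series-vertices (suc n) = refl

mainTheorem13 : (k : ℕ) → k ≥ 1 →
    (enum : ℕ → List Tree) → IsEnumeration enum →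
    (S : FPS) → IsSqrt S disc →
    (U : FPS) → IsInverse U (four ⊛ S) →
    (n : ℕ) → G enum k n ≡ ((L enum k ⊛ (threeMinusX ⊕ S)) ⊛ U) n
mainTheorem13 k _ enum isEnum S S-sqrt U U-inverse n =
  trans (G≈series-vertices n) (solution {S} {U} count-0 S-sqrt U-inverse n)
  where
  open GeneratingFunctions.Equations enum isEnum k
  open FunctionalEquations {l = L enum k} count-eq internal-eq vertices-eq nonRootVertices-eq
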